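{- Let $G$ be a connected finite $\delta$-hyperbolic graph. On any strict end-minimal shortest path $P(y,x)$ from a vertex $y$ to a vertex $x$, the number of vertices $v$ with $loc(v)>1$ is at most $4\delta$. If additionally $x\in C(G)$, this number is at most $\max\{0,4\delta-1\}$.
   Context: $G$ is $\delta$-hyperbolic if for any four vertices $u,v,w,x$ the two larger of $d(u,v)+d(w,x)$, $d(u,w)+d(v,x)$, $d(u,x)+d(v,w)$ differ by at most $2\delta$ ($d$ = shortest-path distance). $e(v)=\max_u d(v,u)$, $rad(G)=\min_v e(v)$, $C(G)=\{v: e(v)=rad(G)\}$. Locality: $loc(v)=\min\{d(v,u): e(u)<e(v)\}$ for $v\notin C(G)$, and $loc(v)=0$ for $v\in C(G)$. A shortest path $P(y,x)$ is strict end-minimal if $e(x)<e(v)$ for all $v\in P(y,x)$, $v\ne x$. -}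

module Defs where

open import Data.Nat using (ℕ; zero; suc; _+_; _≤_; _<_; _⊔_; _⊓_; _<ᵇ_; _<?_)
open import Data.Fin using (Fin; zero; suc; fromℕ; inject₁)
open import Data.List using (List; foldr; length; filter)
open import Data.List using () renaming (allFin to listAllFin)
open import Data.Maybe using (Maybe; just; nothing; maybe; fromMaybe)
open import Data.Bool using (if_then_else_)
open import Data.Product using (_×_)
open import Data.Empty using (⊥)
open import Relation.Binary.PropositionalEquality using (_≡_)

record SimpleGraph (n : ℕ) : Set₁ where
  field
    E         : Fin n → Fin n → Set
    E-sym     : ∀ {u v} → E u v → E v u
    E-irrefl  : ∀ {u} → E u u → ⊥
open SimpleGraph public

data Walk {n : ℕ} (E : Fin n → Fin n → Set) : Fin n → Fin n → ℕ → Set where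
  nil  : ∀ {u} → Walk E u u 0
  cons : ∀ {u w v k} → E u w → Walk E w v k → Walk E u v (suc k)

-- d is the shortest-path distance of E: for every u,v there is a walk of
-- length d u v, and no walk is shorter. (Existence of d encodes connectivity.)
IsShortestPathDist : {n : ℕ} → (Fin n → Fin n → Set) → (Fin n → Fin n → ℕ) → Set
IsShortestPathDist {n} E d =
  ∀ (u v : Fin n) → Walk E u v (d u v) × (∀ m → Walk E u v m → d u v ≤ m)

max3 : ℕ → ℕ → ℕ → ℕ
max3 a b c = a ⊔ b ⊔ c

mid3 : ℕ → ℕ → ℕ → ℕ
mid3 a b c = (a ⊓ b) ⊔ (b ⊓ c) ⊔ (a ⊓ c)

-- δ-hyperbolicity, with twoδ = 2δ: the two largest of the three distance
-- sums differ by at most 2δ.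
IsHyperbolic : {n : ℕ} → (Fin n → Fin n → ℕ) → (twoδ : ℕ) → Set
IsHyperbolic {n} d twoδ =
  ∀ (u v w x : Fin n) →
    max3 (d u v + d w x) (d u w + d v x) (d u x + d v w)
      ≤ mid3 (d u v + d w x) (d u w + d v x) (d u x + d v w) + twoδ

ecc : {n : ℕ} → (Fin n → Fin n → ℕ) → Fin n → ℕ
ecc {n} d v = foldr (λ u acc → d v u ⊔ acc) 0 (listAllFin n)

IsCentral : {n : ℕ} → (Fin n → Fin n → ℕ) → Fin n → Set
IsCentral {n} d v = ∀ (u : Fin n) → ecc d v ≤ ecc d u

-- loc(v) = min { d(v,u) : e(u) < e(v) }, and 0 if this set is empty
-- (the set is empty exactly when v ∈ C(G)).
locOpt : {n : ℕ} → (Fin n → Fin n → ℕ) → Fin n → Maybe ℕ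
locOpt {n} d v =
  foldr (λ u acc → if ecc d u <ᵇ ecc d v
                     then just (maybe (λ m → d v u ⊓ m) (d v u) acc)
                     else acc)
        nothing (listAllFin n)

loc : {n : ℕ} → (Fin n → Fin n → ℕ) → Fin n → ℕ
loc d v = fromMaybe 0 (locOpt d v)

IsShortestPath : {n : ℕ} → (Fin n → Fin n → Set) → (Fin n → Fin n → ℕ) →
                 (y x : Fin n) → (k : ℕ) → (Fin (suc k) → Fin n) → Set
IsShortestPath E d y x k p =
  (p zero ≡ y) × (p (fromℕ k) ≡ x) ×
  (∀ (i : Fin k) → E (p (inject₁ i)) (p (suc i))) × (k ≡ d y x)

IsStrictEndMinimal : {n : ℕ} → (Fin n → Fin n → ℕ) → (x : Fin n) →
                     (k : ℕ) → (Fin (suc k) → Fin n) → Set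
IsStrictEndMinimal d x k p = ∀ (i : Fin k) → ecc d x < ecc d (p (inject₁ i))

countLocGt1 : {n : ℕ} → (Fin n → Fin n → ℕ) → (k : ℕ) → (Fin (suc k) → Fin n) → ℕ
countLocGt1 d k p = length (filter (λ i → 1 <? loc d (p i)) (listAllFin (suc k)))

-- Write the path as y = q 0, …, q k = x and f i = e(q i). Along the path f drops by at most
-- one per step, and it cannot drop at all after a vertex with loc > 1 (the next vertex would
-- be an adjacent vertex of smaller eccentricity). So b + f b - f 0 is at least the number of
-- vertices with loc > 1 among q 0, …, q (b-1). The four-point condition for y, q b, x and a
-- vertex farthest from q b gives b + f b ≤ f 0 + 2δ whenever b + 2δ ≤ k, because e(x) < f b.
-- Hence at most 2δ such vertices precede q (k-2δ), at most 2δ-1 lie in the remaining window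
-- (q (k-1) is adjacent to x), and x adds at most one: none when x is central, and none when
-- δ = 0, since in a 0-hyperbolic graph every vertex has loc ≤ 1.
module Submission where

open import Defs
open import Data.Nat using (ℕ; zero; suc; _+_; _*_; _∸_; _≤_; _<_; _⊔_; _⊓_; _<ᵇ_; _<?_; _≤?_; z≤n; s≤s)
open import Data.Nat.Properties
open import Data.Nat.Tactic.RingSolver using (solve-∀)
open import Data.Fin using (Fin; zero; suc; toℕ; fromℕ; fromℕ<; inject₁)
open import Data.Fin.Properties using (any?; toℕ-fromℕ; toℕ-fromℕ<; toℕ-inject₁)
open import Data.List using ([]; _∷_; [_]; _++_; foldr; length; filter; tabulate; applyUpTo)
open import Data.List using () renaming (allFin to listAllFin)
open import Data.List.Properties
  using (applyUpTo-∷ʳ; filter-++; length-++; length-filter; length-applyUpTo; filter-reject)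
open import Data.List.Membership.Propositional using (_∈_)
open import Data.List.Membership.Propositional.Properties using (∈-allFin)
open import Data.List.Relation.Unary.Any using (here; there)
open import Data.Maybe using (Maybe; just; nothing; maybe; fromMaybe)
open import Data.Bool using (true; false; if_then_else_; T)
open import Data.Unit using (tt)
open import Data.Product using (_×_; _,_; proj₁; proj₂; ∃)
open import Data.Sum using (_⊎_; inj₁; inj₂)
open import Function using (_∘_)
open import Relation.Nullary using (¬_; yes; no; contradiction)
open import Relation.Unary using (Decidable)
open import Relation.Binary.PropositionalEquality
  using (_≡_; refl; sym; trans; cong; cong₂; subst; subst₂; module ≡-Reasoning)

module _ {A : Set} {Q : A → Set} (Q? : Decidable Q) (s : ℕ → A) where

  count : ℕ → ℕ
  count m = length (filter Q? (applyUpTo s m))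

  count-suc : ∀ m → count (suc m) ≡ count m + length (filter Q? [ s m ])
  count-suc m = begin
    length (filter Q? (applyUpTo s (suc m)))                 ≡⟨ cong (length ∘ filter Q?) (applyUpTo-∷ʳ s m) ⟨
    length (filter Q? (applyUpTo s m ++ [ s m ]))            ≡⟨ cong length (filter-++ Q? (applyUpTo s m) [ s m ]) ⟩
    length (filter Q? (applyUpTo s m) ++ filter Q? [ s m ])  ≡⟨ length-++ (filter Q? (applyUpTo s m)) ⟩
    count m + length (filter Q? [ s m ])                     ∎
    where open ≡-Reasoning

  count-suc≤ : ∀ m → count (suc m) ≤ suc (count m)
  count-suc≤ m = begin
    count (suc m)                         ≡⟨ count-suc m ⟩
    count m + length (filter Q? [ s m ])  ≤⟨ +-monoʳ-≤ (count m) (length-filter Q? [ s m ]) ⟩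
    count m + 1                           ≡⟨ +-comm (count m) 1 ⟩
    suc (count m)                         ∎
    where open ≤-Reasoning

  count-suc-reject : ∀ {m} → ¬ Q (s m) → count (suc m) ≡ count m
  count-suc-reject {m} ¬Q = begin
    count (suc m)                         ≡⟨ count-suc m ⟩
    count m + length (filter Q? [ s m ])  ≡⟨ cong (λ xs → count m + length xs) (filter-reject Q? ¬Q) ⟩
    count m + 0                           ≡⟨ +-identityʳ (count m) ⟩
    count m                               ∎
    where open ≡-Reasoning

  count≤ : ∀ m → count m ≤ m
  count≤ m = ≤-trans (length-filter Q? (applyUpTo s m)) (≤-reflexive (length-applyUpTo s m))

  count-+≤ : ∀ m b → count (m + b) ≤ m + count b
  count-+≤ zero    b = ≤-refl
  count-+≤ (suc m) b = ≤-trans (count-suc≤ (m + b)) (s≤s (count-+≤ m b))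

  module _ (f : ℕ → ℕ) {k : ℕ}
           (ascent  : ∀ {i} → i < k → Q (s i) → f i ≤ f (suc i))
           (descent : ∀ {i} → i < k → f i ≤ suc (f (suc i))) where

    f[0]+count[b]≤b+f[b] : ∀ {b} → b ≤ k → f 0 + count b ≤ b + f b
    f[0]+count[b]≤b+f[b] {zero}  _   = ≤-reflexive (+-identityʳ (f 0))
    f[0]+count[b]≤b+f[b] {suc b} b<k with Q? (s b)
    ... | yes Qb = begin
      f 0 + count (suc b)    ≤⟨ +-monoʳ-≤ (f 0) (count-suc≤ b) ⟩
      f 0 + suc (count b)    ≡⟨ +-suc (f 0) (count b) ⟩
      suc (f 0 + count b)    ≤⟨ s≤s (f[0]+count[b]≤b+f[b] (<⇒≤ b<k)) ⟩
      suc (b + f b)          ≤⟨ s≤s (+-monoʳ-≤ b (ascent b<k Qb)) ⟩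
      suc b + f (suc b)      ∎
      where open ≤-Reasoning
    ... | no ¬Qb = begin
      f 0 + count (suc b)    ≡⟨ cong (f 0 +_) (count-suc-reject ¬Qb) ⟩
      f 0 + count b          ≤⟨ f[0]+count[b]≤b+f[b] (<⇒≤ b<k) ⟩
      b + f b                ≤⟨ +-monoʳ-≤ b (descent b<k) ⟩
      b + suc (f (suc b))    ≡⟨ +-suc b (f (suc b)) ⟩
      suc b + f (suc b)      ∎
      where open ≤-Reasoning

    count≤slack : ∀ {t b} → (∀ {b} → b < k → b + t ≤ k → b + f b ≤ f 0 + t) →
                  b < k → b + t ≤ k → count b ≤ t
    count≤slack bound b<k b+t≤k =
      +-cancelˡ-≤ (f 0) _ _ (≤-trans (f[0]+count[b]≤b+f[b] (<⇒≤ b<k)) (bound b<k b+t≤k))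

  count-bound : ∀ (f : ℕ → ℕ) {k t} →
    (∀ {i} → i < k → Q (s i) → f i ≤ f (suc i)) →
    (∀ {i} → i < k → f i ≤ suc (f (suc i))) →
    (∀ {b} → b < k → b + t ≤ k → b + f b ≤ f 0 + t) →
    (∀ {i} → suc i ≡ k → ¬ Q (s i)) →
    count k ≤ 2 * t ∸ 1
  count-bound f {zero} _ _ _ _ = z≤n
  count-bound f {suc k} {zero} ascent descent bound last
    rewrite count-suc-reject (last refl) =
      count≤slack f ascent descent bound ≤-refl (≤-trans (≤-reflexive (+-identityʳ k)) (n≤1+n k))
  count-bound f {suc k} {suc t} ascent descent bound last
    rewrite count-suc-reject (last refl) with t ≤? k
  -- The first k ∸ t indices contribute at most suc t by the potential bound, the last t at most t.
  ... | yes t≤k = begin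
    count k                 ≡⟨ cong count (m+[n∸m]≡n t≤k) ⟨
    count (t + (k ∸ t))     ≤⟨ count-+≤ t (k ∸ t) ⟩
    t + count (k ∸ t)       ≤⟨ +-monoʳ-≤ t (count≤slack f ascent descent bound (s≤s (m∸n≤m k t)) window) ⟩
    t + suc t               ≡⟨ cong (t +_) (+-identityʳ (suc t)) ⟨
    2 * suc t ∸ 1           ∎
    where
      open ≤-Reasoning
      window : k ∸ t + suc t ≤ suc k
      window = ≤-reflexive (trans (+-suc (k ∸ t) t) (cong suc (m∸n+n≡m t≤k)))
  ... | no t≰k = ≤-trans (count≤ k) (≤-trans (<⇒≤ (≰⇒> t≰k)) (m≤m+n t (suc t + 0)))

  count-suc-bound : ∀ {k t} → count k ≤ 2 * t ∸ 1 → (t ≡ 0 → ¬ Q (s k)) → count (suc k) ≤ 2 * t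
  count-suc-bound {k} {zero}  c end = ≤-trans (≤-reflexive (count-suc-reject (end refl))) c
  count-suc-bound {k} {suc t} c _   = ≤-trans (count-suc≤ k) (s≤s c)

≤⊔+⇒⊎ : ∀ {a b c t} → a ≤ b ⊔ c + t → a ≤ b + t ⊎ a ≤ c + t
≤⊔+⇒⊎ {a} {b} {c} {t} le with ⊔-sel b c
... | inj₁ eq = inj₁ (subst (λ m → a ≤ m + t) eq le)
... | inj₂ eq = inj₂ (subst (λ m → a ≤ m + t) eq le)

mid3≤⊔ : ∀ a b c → mid3 a b c ≤ a ⊔ c
mid3≤⊔ a b c = ⊔-lub (⊔-lub (≤-trans (m⊓n≤m a b) (m≤m⊔n a c)) (≤-trans (m⊓n≤n b c) (m≤n⊔m a c)))
                     (≤-trans (m⊓n≤m a c) (m≤m⊔n a c))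

module _ {A : Set} (h : A → ℕ) where

  ≤-foldr-⊔ : ∀ xs {u} → u ∈ xs → h u ≤ foldr (λ u acc → h u ⊔ acc) 0 xs
  ≤-foldr-⊔ (x ∷ xs) (here refl) = m≤m⊔n (h x) _
  ≤-foldr-⊔ (x ∷ xs) (there u∈xs) = ≤-trans (≤-foldr-⊔ xs u∈xs) (m≤n⊔m (h x) _)

  foldr-⊔-attained : A → ∀ xs → ∃ λ u → foldr (λ u acc → h u ⊔ acc) 0 xs ≤ h u
  foldr-⊔-attained z [] = z , z≤n
  foldr-⊔-attained z (x ∷ xs) with ⊔-sel (h x) (foldr (λ u acc → h u ⊔ acc) 0 xs)
  ... | inj₁ eq = x , ≤-reflexive eq
  ... | inj₂ eq = let u , le = foldr-⊔-attained z xs in u , ≤-trans (≤-reflexive eq) le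

module _ {n : ℕ} (d : Fin n → Fin n → ℕ) where

  d≤ecc : ∀ v u → d v u ≤ ecc d v
  d≤ecc v u = ≤-foldr-⊔ (d v) (listAllFin n) (∈-allFin u)

  ecc-attained : ∀ v → ∃ λ u → ecc d v ≤ d v u
  ecc-attained v = foldr-⊔-attained (d v) v (listAllFin n)

  private
    locStep : Fin n → Fin n → Maybe ℕ → Maybe ℕ
    locStep v u acc = if ecc d u <ᵇ ecc d v then just (maybe (λ m → d v u ⊓ m) (d v u) acc) else acc

    locFold-bounded : ∀ {v u} xs → u ∈ xs → ecc d u < ecc d v →
                      ∃ λ m → foldr (locStep v) nothing xs ≡ just m × m ≤ d v u
    locFold-bounded {v} (x ∷ xs) (here refl) lt with ecc d x <ᵇ ecc d v | <⇒<ᵇ lt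
    ... | true | _ with foldr (locStep v) nothing xs
    ...   | nothing = _ , refl , ≤-refl
    ...   | just m  = _ , refl , m⊓n≤m (d v x) m
    locFold-bounded {v} (x ∷ xs) (there u∈xs) lt with locFold-bounded xs u∈xs lt
    ... | m , eq , le with ecc d x <ᵇ ecc d v
    ...   | false = m , eq , le
    ...   | true rewrite eq = _ , refl , ≤-trans (m⊓n≤n (d v x) m) le

    locFold-central : ∀ {v} xs → IsCentral d v → foldr (locStep v) nothing xs ≡ nothing
    locFold-central [] _ = refl
    locFold-central {v} (x ∷ xs) central with ecc d x <ᵇ ecc d v in lt
    ... | true  = contradiction (central x) (<⇒≱ (<ᵇ⇒< _ _ (subst T (sym lt) tt)))
    ... | false = locFold-central xs central

  loc≤d : ∀ {v u} → ecc d u < ecc d v → loc d v ≤ d v u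
  loc≤d {v} lt with locFold-bounded (listAllFin n) (∈-allFin _) lt
  ... | m , eq , le = subst (λ r → fromMaybe 0 r ≤ d v _) (sym eq) le

  loc-central : ∀ {v} → IsCentral d v → loc d v ≡ 0
  loc-central central = cong (fromMaybe 0) (locFold-central (listAllFin n) central)

  four-point : ∀ {t} → IsHyperbolic d t → ∀ a b c e →
    d a c + d b e ≤ d a b + d c e + t ⊎ d a c + d b e ≤ d a e + d b c + t
  four-point {t} H a b c e = ≤⊔+⇒⊎ {b = S₁} {c = S₃} (≤-trans (≤-trans (m≤n⊔m S₁ S₂) (m≤m⊔n (S₁ ⊔ S₂) S₃))
                                             (≤-trans (H a b c e) (+-monoˡ-≤ t (mid3≤⊔ S₁ S₂ S₃))))
    where
      S₁ = d a b + d c e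
      S₂ = d a c + d b e
      S₃ = d a e + d b c

  ecc-four-point : ∀ {t} → IsHyperbolic d t → ∀ a b c →
    d a c + ecc d b ≤ d a b + ecc d c + t ⊎ d a c + ecc d b ≤ ecc d a + d b c + t
  ecc-four-point {t} H a b c with ecc-attained b
  ... | u , eccb≤ with four-point H a b c u
  ...   | inj₁ le = inj₁ (≤-trans (+-monoʳ-≤ (d a c) eccb≤)
                           (≤-trans le (+-monoˡ-≤ t (+-monoʳ-≤ (d a b) (d≤ecc c u)))))
  ...   | inj₂ le = inj₂ (≤-trans (+-monoʳ-≤ (d a c) eccb≤)
                           (≤-trans le (+-monoˡ-≤ t (+-monoˡ-≤ (d b c) (d≤ecc a u)))))

  geodesic-ecc-drop : ∀ {t} → IsHyperbolic d t → ∀ {y v x b} →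
    d y v ≤ b → b + d v x ≤ d y x → b + t ≤ d y x → ecc d x < ecc d v →
    b + ecc d v ≤ ecc d y + t
  geodesic-ecc-drop {t} H {y} {v} {x} {b} yv≤b bvx≤yx b+t≤yx x<v with ecc-four-point H y v x
  ... | inj₁ le = contradiction le (<⇒≱ (begin-strict
    d y v + ecc d x + t    ≤⟨ +-monoˡ-≤ t (+-monoˡ-≤ (ecc d x) yv≤b) ⟩
    b + ecc d x + t        ≡⟨ swap-last b (ecc d x) t ⟩
    b + t + ecc d x        ≤⟨ +-monoˡ-≤ (ecc d x) b+t≤yx ⟩
    d y x + ecc d x        <⟨ +-monoʳ-< (d y x) x<v ⟩
    d y x + ecc d v        ∎))
    where
      open ≤-Reasoning
      swap-last : ∀ a b c → a + b + c ≡ a + c + b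
      swap-last = solve-∀
  ... | inj₂ le = +-cancelˡ-≤ (d y x) _ _ (begin
    d y x + (b + ecc d v)          ≡⟨ swap-first (d y x) b (ecc d v) ⟩
    b + (d y x + ecc d v)          ≤⟨ +-monoʳ-≤ b le ⟩
    b + (ecc d y + d v x + t)      ≡⟨ regroup b (ecc d y) (d v x) t ⟩
    b + d v x + (ecc d y + t)      ≤⟨ +-monoˡ-≤ (ecc d y + t) bvx≤yx ⟩
    d y x + (ecc d y + t)          ∎)
    where
      open ≤-Reasoning
      swap-first : ∀ a b c → a + (b + c) ≡ b + (a + c)
      swap-first = solve-∀
      regroup : ∀ b e c t → b + (e + c + t) ≡ b + c + (e + t)
      regroup = solve-∀

module _ {n : ℕ} {E : Fin n → Fin n → Set} {d : Fin n → Fin n → ℕ} (sp : IsShortestPathDist E d) where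

  _++ʷ_ : ∀ {u v w l m} → Walk E u v l → Walk E v w m → Walk E u w (l + m)
  nil      ++ʷ w₂ = w₂
  cons e w ++ʷ w₂ = cons e (w ++ʷ w₂)

  d≤length : ∀ {u v m} → Walk E u v m → d u v ≤ m
  d≤length {u} {v} w = proj₂ (sp u v) _ w

  d-edge≤1 : ∀ {u v} → E u v → d u v ≤ 1
  d-edge≤1 e = d≤length (cons e nil)

  triangle : ∀ u v w → d u w ≤ d u v + d v w
  triangle u v w = d≤length (proj₁ (sp u v) ++ʷ proj₁ (sp v w))

  ecc≤d+ecc : ∀ u v → ecc d u ≤ d u v + ecc d v
  ecc≤d+ecc u v with ecc-attained d u
  ... | w , eccu≤ = ≤-trans eccu≤ (≤-trans (triangle u v w) (+-monoʳ-≤ (d u v) (d≤ecc d v w)))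

  lower-neighbour⇒loc≤1 : ∀ {v w} → E v w → ecc d w < ecc d v → loc d v ≤ 1
  lower-neighbour⇒loc≤1 e w<v = ≤-trans (loc≤d d w<v) (d-edge≤1 e)

  0-hyperbolic⇒loc≤1 : IsHyperbolic d 0 → ∀ v → loc d v ≤ 1
  0-hyperbolic⇒loc≤1 H v with any? (λ c → ecc d c <? ecc d v)
  ... | no ∄lower = ≤-trans (≤-reflexive (loc-central d (λ u → ≮⇒≥ (λ u<v → ∄lower (u , u<v))))) z≤n
  ... | yes (c , c<v) = descend (proj₁ (sp v c)) ≤-refl c<v
    where
      descend : ∀ {c m} → Walk E v c m → m ≤ d v c → ecc d c < ecc d v → loc d v ≤ 1
      descend nil              _   c<v = contradiction c<v (<-irrefl refl)
      descend {c} (cons {w = w} e rest) m≤d c<v = lower-neighbour⇒loc≤1 e w<v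
        where
          w<v : ecc d w < ecc d v
          w<v with ecc d c <? ecc d w
          ... | yes c<w = subst (ecc d w <_) (+-identityʳ (ecc d v))
                            (geodesic-ecc-drop d H (d-edge≤1 e) (≤-trans (s≤s (d≤length rest)) m≤d)
                                               (≤-trans (s≤s z≤n) m≤d) c<w)
          ... | no c≮w = ≤-<-trans (≮⇒≥ c≮w) c<v

  module Geodesic (q : ℕ → Fin n) {k : ℕ}
                  (edge : ∀ {i} → i < k → E (q i) (q (suc i)))
                  (length≡k : d (q 0) (q k) ≡ k)
                  (end-minimal : ∀ {i} → i < k → ecc d (q k) < ecc d (q i)) where

    walk-along : ∀ m {i} → m + i ≤ k → Walk E (q i) (q (m + i)) m
    walk-along zero    _  = nil
    walk-along (suc m) {i} le =
      cons (edge (≤-trans (s≤s (m≤n+m i m)) le))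
           (subst (λ j → Walk E (q (suc i)) (q j) m) (+-suc m i)
                  (walk-along m (≤-trans (≤-reflexive (+-suc m i)) le)))

    d-from-start : ∀ {b} → b ≤ k → d (q 0) (q b) ≤ b
    d-from-start {b} b≤k =
      d≤length (subst (λ j → Walk E (q 0) (q j) b) (+-identityʳ b)
                      (walk-along b (≤-trans (≤-reflexive (+-identityʳ b)) b≤k)))

    d-to-end : ∀ {b} → b ≤ k → b + d (q b) (q k) ≤ k
    d-to-end {b} b≤k = begin
      b + d (q b) (q k)  ≤⟨ +-monoʳ-≤ b (d≤length (subst (λ j → Walk E (q b) (q j) (k ∸ b)) rest
                                                        (walk-along (k ∸ b) (≤-reflexive rest)))) ⟩
      b + (k ∸ b)        ≡⟨ m+[n∸m]≡n b≤k ⟩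
      k                  ∎
      where
        open ≤-Reasoning
        rest : k ∸ b + b ≡ k
        rest = m∸n+n≡m b≤k

    ecc-rises-at-loc>1 : ∀ {i} → i < k → 1 < loc d (q i) → ecc d (q i) ≤ ecc d (q (suc i))
    ecc-rises-at-loc>1 {i} i<k loc>1 with ecc d (q i) ≤? ecc d (q (suc i))
    ... | yes rises = rises
    ... | no  falls = contradiction loc>1 (≤⇒≯ (lower-neighbour⇒loc≤1 (edge i<k) (≰⇒> falls)))

    ecc-falls-by≤1 : ∀ {i} → i < k → ecc d (q i) ≤ suc (ecc d (q (suc i)))
    ecc-falls-by≤1 {i} i<k =
      ≤-trans (ecc≤d+ecc (q i) (q (suc i))) (+-monoˡ-≤ (ecc d (q (suc i))) (d-edge≤1 (edge i<k)))

    ecc-drop : ∀ {t} → IsHyperbolic d t → ∀ {b} → b < k → b + t ≤ k → b + ecc d (q b) ≤ ecc d (q 0) + t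
    ecc-drop {t} H {b} b<k b+t≤k =
      geodesic-ecc-drop d H (d-from-start (<⇒≤ b<k))
        (subst (b + d (q b) (q k) ≤_) (sym length≡k) (d-to-end (<⇒≤ b<k)))
        (subst (b + t ≤_) (sym length≡k) b+t≤k)
        (end-minimal b<k)

    loc≤1-before-end : ∀ {i} → suc i ≡ k → ¬ 1 < loc d (q i)
    loc≤1-before-end {i} refl =
      ≤⇒≯ (lower-neighbour⇒loc≤1 (edge ≤-refl) (end-minimal ≤-refl))

-- clamp k i = min i k, so p ∘ clamp k extends a path p : Fin (suc k) → _ constantly beyond k.
clamp : ∀ k → ℕ → Fin (suc k)
clamp k       zero    = zero
clamp zero    (suc i) = zero
clamp (suc k) (suc i) = suc (clamp k i)

clamp-toℕ : ∀ {k} (j : Fin (suc k)) → clamp k (toℕ j) ≡ j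
clamp-toℕ         zero    = refl
clamp-toℕ {suc k} (suc j) = cong suc (clamp-toℕ j)

clamp-inject₁ : ∀ {k} (j : Fin k) → clamp k (toℕ j) ≡ inject₁ j
clamp-inject₁ {k} j = trans (cong (clamp k) (sym (toℕ-inject₁ j))) (clamp-toℕ (inject₁ j))

clamp-fromℕ : ∀ k → clamp k k ≡ fromℕ k
clamp-fromℕ k = trans (cong (clamp k) (sym (toℕ-fromℕ k))) (clamp-toℕ (fromℕ k))

clamp-suc : ∀ {k} (j : Fin k) → clamp k (suc (toℕ j)) ≡ suc j
clamp-suc {suc k} j = cong suc (clamp-toℕ j)

∀-inject₁⇒∀< : ∀ {k} {P : Fin (suc k) → Set} → (∀ (j : Fin k) → P (inject₁ j)) →
               ∀ {i} → i < k → P (clamp k i)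
∀-inject₁⇒∀< {k} {P} h i<k =
  subst (P ∘ clamp k) (toℕ-fromℕ< i<k) (subst P (sym (clamp-inject₁ j)) (h j))
  where j = fromℕ< i<k

∀-step⇒∀< : ∀ {k} {R : Fin (suc k) → Fin (suc k) → Set} → (∀ (j : Fin k) → R (inject₁ j) (suc j)) →
            ∀ {i} → i < k → R (clamp k i) (clamp k (suc i))
∀-step⇒∀< {k} {R} h i<k =
  subst (λ i → R (clamp k i) (clamp k (suc i))) (toℕ-fromℕ< i<k)
        (subst₂ R (sym (clamp-inject₁ j)) (sym (clamp-suc j)) (h j))
  where j = fromℕ< i<k

tabulate≡applyUpTo : ∀ {A : Set} {m} {f : Fin m → A} {g : ℕ → A} →
                     (∀ j → f j ≡ g (toℕ j)) → tabulate f ≡ applyUpTo g m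
tabulate≡applyUpTo {m = zero}  _  = refl
tabulate≡applyUpTo {m = suc m} eq = cong₂ _∷_ (eq zero) (tabulate≡applyUpTo (eq ∘ suc))

corollary21 : ∀ {n : ℕ} (G : SimpleGraph n) (d : Fin n → Fin n → ℕ) (twoδ : ℕ) →
    IsShortestPathDist (E G) d → IsHyperbolic d twoδ →
    ∀ (y x : Fin n) (k : ℕ) (p : Fin (suc k) → Fin n) →
    IsShortestPath (E G) d y x k p → IsStrictEndMinimal d x k p →
    (countLocGt1 d k p ≤ 2 * twoδ) ×
    (IsCentral d x → countLocGt1 d k p ≤ 2 * twoδ ∸ 1)
corollary21 G d t sp H .(p zero) .(p (fromℕ k)) k p (refl , refl , edges , k≡d) end-minimal =
  subst (_≤ 2 * t) (sym counted) (count-suc-bound Q? (clamp k) before-end end-if-tree) ,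
  λ central → subst (_≤ 2 * t ∸ 1) (sym counted)
                (≤-trans (≤-reflexive (count-suc-reject Q? (clamp k) (end-if-central central))) before-end)
  where
    Q? : Decidable (λ j → 1 < loc d (p j))
    Q? j = 1 <? loc d (p j)
    counted : countLocGt1 d k p ≡ count Q? (clamp k) (suc k)
    counted = cong (length ∘ filter Q?) (tabulate≡applyUpTo {g = clamp k} (sym ∘ clamp-toℕ))
    q = p ∘ clamp k
    q-end : q k ≡ p (fromℕ k)
    q-end = cong p (clamp-fromℕ k)
    q-edge : ∀ {i} → i < k → E G (q i) (q (suc i))
    q-edge = ∀-step⇒∀< {R = λ a b → E G (p a) (p b)} edges
    q-length : d (q 0) (q k) ≡ k
    q-length = trans (cong (d (p zero)) q-end) (sym k≡d)
    q-end-minimal : ∀ {i} → i < k → ecc d (q k) < ecc d (q i)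
    q-end-minimal {i} i<k rewrite q-end = ∀-inject₁⇒∀< {P = λ a → ecc d (p (fromℕ k)) < ecc d (p a)} end-minimal i<k
    open Geodesic sp q q-edge q-length q-end-minimal
    before-end : count Q? (clamp k) k ≤ 2 * t ∸ 1
    before-end = count-bound Q? (clamp k) (ecc d ∘ q)
                   ecc-rises-at-loc>1 ecc-falls-by≤1 (ecc-drop H) loc≤1-before-end
    end-if-tree : t ≡ 0 → ¬ 1 < loc d (q k)
    end-if-tree refl = ≤⇒≯ (0-hyperbolic⇒loc≤1 sp H (q k))
    end-if-central : IsCentral d (p (fromℕ k)) → ¬ 1 < loc d (q k)
    end-if-central central rewrite q-end | loc-central d central = λ ()
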